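{- Let $A$ be a nonrecursive c.e. $D$-maximal set of Type 1. Then the many-one degree of $A$ contains a least finite-one degree, i.e. there is $C\equiv_{\rm m}A$ with $C\le_{\rm fo}B$ for every $B\equiv_{\rm m}A$.
   Context: All sets are subsets of $\omega$; $X\subseteq^*Y$ means $X\setminus Y$ finite. $A\le_{\rm m}B$: there is total computable $f$ with $x\in A\iff f(x)\in B$; $\equiv_{\rm m}$ is mutual $\le_{\rm m}$. $A\le_{\rm fo}B$: there is total computable $g$ with $x\in A\iff g(x)\in B$ and every fibre $g^{ -1}(\{y\})$ finite. A noncomputable c.e. set $A$ is $D$-maximal if for every c.e. $W\supseteq A$, either $W\setminus A$ is c.e. or there is a computable $R$ with $A\subseteq R\subseteq W$. For a c.e. set $A$, $\mathcal D(A)$ is the family of c.e. sets disjoint from $A$; a finite or countable family $\{G_i:i\in I\}$ of c.e. sets disjoint from $A$ generates $\mathcal D(A)$ if every c.e. $D$ disjoint from $A$ satisfies $D\subseteq^*\bigcup_{i\in F}G_i$ for some finite $F\subseteq I$. $A$ is of Type 1 if $\mathcal D(A)$ is generated by $\{\varnothing\}$ (i.e. every c.e. set disjoint from $A$ is finite). -}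

module Defs where

open import Level using (0ℓ)
open import Data.Nat using (ℕ; zero; suc; _<_)
open import Data.Fin using (Fin)
open import Data.Vec using (Vec; []; _∷_; lookup)
open import Data.Product using (Σ; Σ-syntax; _×_; _,_)
open import Data.Sum using (_⊎_)
open import Data.Empty using (⊥)
open import Relation.Nullary using (¬_)
open import Relation.Binary.PropositionalEquality using (_≡_)
open import Function.Bundles using (_⇔_)

data PRF : ℕ → Set where
  zer  : ∀ {n} → PRF n
  succ : PRF 1
  proj : ∀ {n} → Fin n → PRF n
  comp : ∀ {m n} → PRF m → Vec (PRF n) m → PRF n
  prec : ∀ {n} → PRF n → PRF (suc (suc n)) → PRF (suc n)
  mu   : ∀ {n} → PRF (suc n) → PRF n

mutual
  data _⟦_⟧⇓_ : ∀ {n} → PRF n → Vec ℕ n → ℕ → Set where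
    ev-zer  : ∀ {n} {xs : Vec ℕ n} → zer ⟦ xs ⟧⇓ 0
    ev-succ : ∀ {x} → succ ⟦ x ∷ [] ⟧⇓ suc x
    ev-proj : ∀ {n} {i : Fin n} {xs} → proj i ⟦ xs ⟧⇓ lookup xs i
    ev-comp : ∀ {m n} {f : PRF m} {gs : Vec (PRF n) m} {xs ys y} →
              gs ⟦ xs ⟧⇓* ys → f ⟦ ys ⟧⇓ y → comp f gs ⟦ xs ⟧⇓ y
    ev-prec0 : ∀ {n} {f : PRF n} {g xs y} →
               f ⟦ xs ⟧⇓ y → prec f g ⟦ 0 ∷ xs ⟧⇓ y
    ev-precS : ∀ {n} {f : PRF n} {g k xs r y} →
               prec f g ⟦ k ∷ xs ⟧⇓ r → g ⟦ k ∷ r ∷ xs ⟧⇓ y →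
               prec f g ⟦ suc k ∷ xs ⟧⇓ y
    ev-mu   : ∀ {n} {f : PRF (suc n)} {xs y} →
              f ⟦ y ∷ xs ⟧⇓ 0 →
              (∀ z → z < y → Σ[ v ∈ ℕ ] f ⟦ z ∷ xs ⟧⇓ suc v) →
              mu f ⟦ xs ⟧⇓ y

  data _⟦_⟧⇓*_ : ∀ {m n} → Vec (PRF n) m → Vec ℕ n → Vec ℕ m → Set where
    ev-[] : ∀ {n} {xs : Vec ℕ n} → [] ⟦ xs ⟧⇓* []
    ev-∷  : ∀ {m n} {g : PRF n} {gs : Vec (PRF n) m} {xs y ys} →
            g ⟦ xs ⟧⇓ y → gs ⟦ xs ⟧⇓* ys → (g ∷ gs) ⟦ xs ⟧⇓* (y ∷ ys)

Pred : Set₁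
Pred = ℕ → Set

_⊆_ : Pred → Pred → Set
A ⊆ B = ∀ x → A x → B x

Disjoint : Pred → Pred → Set
Disjoint A B = ∀ x → A x → B x → ⊥

_∖_ : Pred → Pred → Pred
(W ∖ A) x = W x × ¬ A x

Finite : Pred → Set
Finite D = Σ[ n ∈ ℕ ] (∀ x → D x → x < n)

ComputableFn : (ℕ → ℕ) → Set
ComputableFn f = Σ[ e ∈ PRF 1 ] (∀ x → e ⟦ x ∷ [] ⟧⇓ f x)

Computable : Pred → Set
Computable A = Σ[ χ ∈ (ℕ → ℕ) ] (ComputableFn χ × (∀ x → A x ⇔ (χ x ≡ 0)))

CE : Pred → Set
CE A = Σ[ e ∈ PRF 1 ] (∀ x → A x ⇔ (Σ[ y ∈ ℕ ] e ⟦ x ∷ [] ⟧⇓ y))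

_≤m_ : Pred → Pred → Set
A ≤m B = Σ[ f ∈ (ℕ → ℕ) ] (ComputableFn f × (∀ x → A x ⇔ B (f x)))

_≡m_ : Pred → Pred → Set
A ≡m B = (A ≤m B) × (B ≤m A)

_≤fo_ : Pred → Pred → Set
A ≤fo B = Σ[ g ∈ (ℕ → ℕ) ] (ComputableFn g × (∀ x → A x ⇔ B (g x))
            × (∀ y → Finite (λ x → g x ≡ y)))

DMaximal : Pred → Set₁
DMaximal A = CE A × ¬ Computable A ×
  (∀ (W : Pred) → CE W → A ⊆ W →
     CE (W ∖ A) ⊎ (Σ[ R ∈ Pred ] (Computable R × A ⊆ R × R ⊆ W)))

Type1 : Pred → Set₁
Type1 A = ∀ (D : Pred) → CE D → Disjoint D A → Finite D

module Submission where

-- Take C = A.  Given B ≡m A, fix f : A ≤m B and call x repeated if f z = f x for some z < x.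
-- As A ∪ Repeated f is c.e., D-maximality leaves two cases: either Repeated f ∖ A is c.e.,
-- hence finite by Type 1; or a computable R lies between A and A ∪ Repeated f.  In the latter
-- case ∁ R is c.e. and disjoint from A, hence finite, so almost every x ∉ A is repeated; then
-- x ∈ A iff f x avoids the finitely many values f z with z ∉ A unrepeated, and A would be
-- computable.  So almost all repeated x lie in A.  Moreover B is c.e. (as B ≤m A) and
-- unbounded (else A would be computable), so some computable b has k ≤ b k ∈ B.  Sending
-- the repeated x beyond the exceptions to b x instead of f x is still a reduction, and now
-- a fibre consists of small points and at most one unrepeated point.
--
-- Stage-wise enumerations of c.e. sets come from a fuelled evaluator for Kleene's schemes
-- that is itself primitive recursive.

open import Defs
open import Level using (0ℓ)
open import Axiom.ExcludedMiddle using (ExcludedMiddle)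
open import Data.Nat
open import Data.Nat.Properties
open import Data.Nat.Induction using (<-rec)
open import Data.Fin using (Fin; _↑ʳ_) renaming (zero to fzero; suc to fsuc)
open import Data.Vec using (Vec; []; _∷_; _++_; lookup; map; head; tail; tabulate)
open import Data.Vec.Properties using (map-∘; map-id; tabulate-∘; tabulate-cong; tabulate∘lookup; lookup-++ʳ)
open import Data.List using (List) renaming ([] to []ᴸ; _∷_ to _∷ᴸ_)
open import Data.List.Membership.Propositional using (_∈_)
open import Data.List.Relation.Unary.Any using (here; there)
open import Data.Product using (Σ-syntax; ∃-syntax; _×_; _,_; proj₁; proj₂)
open import Data.Sum using (_⊎_; inj₁; inj₂)
open import Data.Empty using (⊥)
open import Relation.Nullary using (¬_; Dec; yes; no; contradiction)
open import Relation.Unary using (_∪_; _∩_; ∁)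
open import Relation.Binary using (tri<; tri≈; tri>)
open import Relation.Binary.PropositionalEquality
open import Function.Base using (_∘_; id)
open import Function.Bundles using (_⇔_; mk⇔; Equivalence)
open import Function.Construct.Composition using (_⇔-∘_)
open Equivalence using (to; from)

private
  variable
    m n : ℕ

mutual
  ⇓-functional : {e : PRF n} {xs : Vec ℕ n} {y z : ℕ} → e ⟦ xs ⟧⇓ y → e ⟦ xs ⟧⇓ z → y ≡ z
  ⇓-functional ev-zer ev-zer = refl
  ⇓-functional ev-succ ev-succ = refl
  ⇓-functional ev-proj ev-proj = refl
  ⇓-functional (ev-comp p q) (ev-comp p′ q′) rewrite ⇓*-functional p p′ = ⇓-functional q q′
  ⇓-functional (ev-prec0 p) (ev-prec0 q) = ⇓-functional p q
  ⇓-functional (ev-precS p q) (ev-precS p′ q′) rewrite ⇓-functional p p′ = ⇓-functional q q′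
  ⇓-functional (ev-mu {y = y} p below) (ev-mu {y = y′} p′ below′) with <-cmp y y′
  ... | tri< y<y′ _ _ = contradiction (⇓-functional p (proj₂ (below′ y y<y′))) 0≢1+n
  ... | tri≈ _ y≡y′ _ = y≡y′
  ... | tri> _ _ y′<y = contradiction (⇓-functional p′ (proj₂ (below y′ y′<y))) 0≢1+n

  ⇓*-functional : {gs : Vec (PRF n) m} {xs : Vec ℕ n} {ys zs : Vec ℕ m} →
                  gs ⟦ xs ⟧⇓* ys → gs ⟦ xs ⟧⇓* zs → ys ≡ zs
  ⇓*-functional ev-[] ev-[] = refl
  ⇓*-functional (ev-∷ p ps) (ev-∷ q qs) = cong₂ _∷_ (⇓-functional p q) (⇓*-functional ps qs)

-- Fuelled evaluation: run e s xs is 0 while e has no value on xs within fuel s,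
-- and suc y once it has value y.  The fuel bounds only the length of μ-searches.

ifZero : ℕ → ℕ → ℕ → ℕ
ifZero zero    a b = a
ifZero (suc _) a b = b

whenAllDefined : Vec ℕ m → ℕ → ℕ
whenAllDefined []       b = b
whenAllDefined (v ∷ vs) b = ifZero v 0 (whenAllDefined vs b)

-- The state of a μ-search after testing the arguments below t: 1 while every value
-- was positive, suc (suc y) once a zero was found at y, and 0 if a test ran out of fuel.
muTest : ℕ → ℕ → ℕ
muTest zero    t = 0
muTest (suc v) t = ifZero v (suc (suc t)) 1

muStep : ℕ → ℕ → ℕ → ℕ
muStep zero    v t = 0
muStep (suc r) v t = ifZero r (muTest v t) (suc r)

mutual
  run : PRF n → ℕ → Vec ℕ n → ℕ
  run zer         s xs       = 1
  run succ        s (x ∷ []) = suc (suc x)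
  run (proj i)    s xs       = suc (lookup xs i)
  run (comp f gs) s xs       = whenAllDefined (runAll gs s xs) (run f s (map pred (runAll gs s xs)))
  run (prec f g)  s (k ∷ xs) = runPrec f g s k xs
  run (mu f)      s xs       = pred (runMu f s xs s)

  runAll : Vec (PRF n) m → ℕ → Vec ℕ n → Vec ℕ m
  runAll []       s xs = []
  runAll (g ∷ gs) s xs = run g s xs ∷ runAll gs s xs

  runPrec : PRF n → PRF (suc (suc n)) → ℕ → ℕ → Vec ℕ n → ℕ
  runPrec f g s zero    xs = run f s xs
  runPrec f g s (suc k) xs = ifZero (runPrec f g s k xs) 0 (run g s (k ∷ pred (runPrec f g s k xs) ∷ xs))

  runMu : PRF (suc n) → ℕ → Vec ℕ n → ℕ → ℕ
  runMu f s xs zero    = 1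
  runMu f s xs (suc t) = muStep (runMu f s xs t) (run f s (t ∷ xs)) t

whenAllDefined-inv : (vs : Vec ℕ m) (b : ℕ) {y : ℕ} → whenAllDefined vs b ≡ suc y →
                     Σ[ ys ∈ Vec ℕ m ] (vs ≡ map suc ys × b ≡ suc y)
whenAllDefined-inv []           b eq = [] , refl , eq
whenAllDefined-inv (suc v ∷ vs) b eq with whenAllDefined-inv vs b eq
... | ys , refl , b≡ = v ∷ ys , refl , b≡

whenAllDefined-map-suc : (ys : Vec ℕ m) (b : ℕ) → whenAllDefined (map suc ys) b ≡ b
whenAllDefined-map-suc []       b = refl
whenAllDefined-map-suc (y ∷ ys) b = whenAllDefined-map-suc ys b

map-pred-map-suc : (ys : Vec ℕ m) → map pred (map suc ys) ≡ ys
map-pred-map-suc ys = trans (sym (map-∘ pred suc ys)) (map-id ys)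

run-comp-inv : (f : PRF m) (gs : Vec (PRF n) m) {s : ℕ} {xs : Vec ℕ n} {y : ℕ} →
               run (comp f gs) s xs ≡ suc y →
               Σ[ ys ∈ Vec ℕ m ] (runAll gs s xs ≡ map suc ys × run f s ys ≡ suc y)
run-comp-inv f gs {s} {xs} eq with whenAllDefined-inv (runAll gs s xs) _ eq
... | ys , gs≡ , f≡ =
  ys , gs≡ , trans (cong (run f s) (sym (trans (cong (map pred) gs≡) (map-pred-map-suc ys)))) f≡

run-comp-intro : (f : PRF m) (gs : Vec (PRF n) m) {s : ℕ} {xs : Vec ℕ n} {ys : Vec ℕ m} {y : ℕ} →
                 runAll gs s xs ≡ map suc ys → run f s ys ≡ suc y → run (comp f gs) s xs ≡ suc y
run-comp-intro f gs {s} {ys = ys} gs≡ f≡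
  rewrite gs≡ | map-pred-map-suc ys | whenAllDefined-map-suc ys (run f s ys) = f≡

runPrec-suc-inv : (f : PRF n) (g : PRF (suc (suc n))) {s k : ℕ} {xs : Vec ℕ n} {y : ℕ} →
                  runPrec f g s (suc k) xs ≡ suc y →
                  ∃[ r ] (runPrec f g s k xs ≡ suc r × run g s (k ∷ r ∷ xs) ≡ suc y)
runPrec-suc-inv f g {s} {k} {xs} eq with runPrec f g s k xs
... | suc r = r , refl , eq

runPrec-suc-intro : (f : PRF n) (g : PRF (suc (suc n))) {s k : ℕ} {xs : Vec ℕ n} {r y : ℕ} →
                    runPrec f g s k xs ≡ suc r → run g s (k ∷ r ∷ xs) ≡ suc y →
                    runPrec f g s (suc k) xs ≡ suc y
runPrec-suc-intro f g k≡ g≡ rewrite k≡ = g≡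

PositiveBelow : PRF (suc n) → ℕ → Vec ℕ n → ℕ → Set
PositiveBelow f s xs y = ∀ w → w < y → ∃[ v ] run f s (w ∷ xs) ≡ suc (suc v)

PositiveBelow-suc : (f : PRF (suc n)) {s : ℕ} {xs : Vec ℕ n} {t : ℕ} →
                    PositiveBelow f s xs t → ∃[ v ] run f s (t ∷ xs) ≡ suc (suc v) →
                    PositiveBelow f s xs (suc t)
PositiveBelow-suc f below at-t w w<1+t with m<1+n⇒m<n∨m≡n w<1+t
... | inj₁ w<t  = below w w<t
... | inj₂ refl = at-t

muStep≡1 : ∀ r v t → muStep r v t ≡ 1 → r ≡ 1 × ∃[ u ] v ≡ suc (suc u)
muStep≡1 (suc zero) (suc (suc u)) t _ = refl , u , refl
muStep≡1 (suc zero) (suc zero) t ()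

muStep≡2+ : ∀ r v t {y} → muStep r v t ≡ suc (suc y) → r ≡ suc (suc y) ⊎ (r ≡ 1 × v ≡ 1 × y ≡ t)
muStep≡2+ (suc zero)    (suc zero) t refl = inj₂ (refl , refl , refl)
muStep≡2+ (suc (suc r)) v          t eq   = inj₁ eq
muStep≡2+ (suc zero) (suc (suc u)) t ()

runMu-positive : (f : PRF (suc n)) {s : ℕ} {xs : Vec ℕ n} (t : ℕ) →
                 PositiveBelow f s xs t → runMu f s xs t ≡ 1
runMu-positive f zero    below = refl
runMu-positive f (suc t) below with below t (n<1+n t)
... | v , at-t rewrite runMu-positive f t (λ w w<t → below w (m<n⇒m<1+n w<t)) | at-t = refl

runMu≡1 : (f : PRF (suc n)) {s : ℕ} {xs : Vec ℕ n} (t : ℕ) →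
          runMu f s xs t ≡ 1 → PositiveBelow f s xs t
runMu≡1 f zero    _  w ()
runMu≡1 f {s} {xs} (suc t) eq with muStep≡1 (runMu f s xs t) (run f s (t ∷ xs)) t eq
... | t≡1 , at-t = PositiveBelow-suc f (runMu≡1 f t t≡1) at-t

runMu-found : (f : PRF (suc n)) {s : ℕ} {xs : Vec ℕ n} {y : ℕ} (t : ℕ) → y < t →
              run f s (y ∷ xs) ≡ 1 → PositiveBelow f s xs y → runMu f s xs t ≡ suc (suc y)
runMu-found f (suc t) y<1+t at-y below with m<1+n⇒m<n∨m≡n y<1+t
... | inj₁ y<t  rewrite runMu-found f t y<t at-y below = refl
... | inj₂ refl rewrite runMu-positive f t below | at-y = refl

runMu-inv : (f : PRF (suc n)) {s : ℕ} {xs : Vec ℕ n} {y : ℕ} (t : ℕ) → runMu f s xs t ≡ suc (suc y) →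
            y < t × run f s (y ∷ xs) ≡ 1 × PositiveBelow f s xs y
runMu-inv f {s} {xs} (suc t) eq with muStep≡2+ (runMu f s xs t) (run f s (t ∷ xs)) t eq
... | inj₁ t≡ with runMu-inv f t t≡
...   | y<t , at-y , below = m<n⇒m<1+n y<t , at-y , below
runMu-inv f (suc t) eq | inj₂ (t≡1 , at-t , refl) = n<1+n t , at-t , runMu≡1 f t t≡1

run-mu-inv : (f : PRF (suc n)) {s : ℕ} {xs : Vec ℕ n} {y : ℕ} → run (mu f) s xs ≡ suc y →
             y < s × run f s (y ∷ xs) ≡ 1 × PositiveBelow f s xs y
run-mu-inv f {s} {xs} eq with runMu f s xs s in μ≡
... | suc (suc y) rewrite suc-injective eq = runMu-inv f s μ≡

run-mu-intro : (f : PRF (suc n)) {s : ℕ} {xs : Vec ℕ n} {y : ℕ} → y < s →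
               run f s (y ∷ xs) ≡ 1 → PositiveBelow f s xs y → run (mu f) s xs ≡ suc y
run-mu-intro f {s} y<s at-y below = cong pred (runMu-found f s y<s at-y below)

mutual
  run-sound : (e : PRF n) {s : ℕ} {xs : Vec ℕ n} {y : ℕ} → run e s xs ≡ suc y → e ⟦ xs ⟧⇓ y
  run-sound zer         refl = ev-zer
  run-sound succ {xs = x ∷ []} refl = ev-succ
  run-sound (proj i)    refl = ev-proj
  run-sound (comp f gs) eq with run-comp-inv f gs eq
  ... | _ , gs≡ , f≡ = ev-comp (runAll-sound gs gs≡) (run-sound f f≡)
  run-sound (prec f g) {xs = k ∷ xs} eq = runPrec-sound f g k eq
  run-sound (mu f) {s} eq with run-mu-inv f {s} eq
  ... | _ , at-y , below =
    ev-mu (run-sound f at-y) λ w w<y → proj₁ (below w w<y) , run-sound f (proj₂ (below w w<y))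

  runAll-sound : (gs : Vec (PRF n) m) {s : ℕ} {xs : Vec ℕ n} {ys : Vec ℕ m} →
                 runAll gs s xs ≡ map suc ys → gs ⟦ xs ⟧⇓* ys
  runAll-sound []       {ys = []}     eq = ev-[]
  runAll-sound (g ∷ gs) {ys = y ∷ ys} eq =
    ev-∷ (run-sound g (cong head eq)) (runAll-sound gs (cong tail eq))

  runPrec-sound : (f : PRF n) (g : PRF (suc (suc n))) (k : ℕ) {s : ℕ} {xs : Vec ℕ n} {y : ℕ} →
                  runPrec f g s k xs ≡ suc y → prec f g ⟦ k ∷ xs ⟧⇓ y
  runPrec-sound f g zero    eq = ev-prec0 (run-sound f eq)
  runPrec-sound f g (suc k) eq with runPrec-suc-inv f g eq
  ... | _ , k≡ , g≡ = ev-precS (runPrec-sound f g k k≡) (run-sound g g≡)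

mutual
  run-mono : (e : PRF n) {s s′ : ℕ} {xs : Vec ℕ n} {y : ℕ} → s ≤ s′ →
             run e s xs ≡ suc y → run e s′ xs ≡ suc y
  run-mono zer         s≤s′ eq = eq
  run-mono succ {xs = x ∷ []} s≤s′ eq = eq
  run-mono (proj i)    s≤s′ eq = eq
  run-mono (comp f gs) s≤s′ eq with run-comp-inv f gs eq
  ... | _ , gs≡ , f≡ = run-comp-intro f gs (runAll-mono gs s≤s′ gs≡) (run-mono f s≤s′ f≡)
  run-mono (prec f g) {xs = k ∷ xs} s≤s′ eq = runPrec-mono f g k s≤s′ eq
  run-mono (mu f) {s} s≤s′ eq with run-mu-inv f {s} eq
  ... | y<s , at-y , below = run-mu-intro f (<-≤-trans y<s s≤s′) (run-mono f s≤s′ at-y)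
          λ w w<y → proj₁ (below w w<y) , run-mono f s≤s′ (proj₂ (below w w<y))

  runAll-mono : (gs : Vec (PRF n) m) {s s′ : ℕ} {xs : Vec ℕ n} {ys : Vec ℕ m} → s ≤ s′ →
                runAll gs s xs ≡ map suc ys → runAll gs s′ xs ≡ map suc ys
  runAll-mono []       {ys = []}     s≤s′ eq = refl
  runAll-mono (g ∷ gs) {ys = y ∷ ys} s≤s′ eq =
    cong₂ _∷_ (run-mono g s≤s′ (cong head eq)) (runAll-mono gs s≤s′ (cong tail eq))

  runPrec-mono : (f : PRF n) (g : PRF (suc (suc n))) (k : ℕ) {s s′ : ℕ} {xs : Vec ℕ n} {y : ℕ} → s ≤ s′ →
                 runPrec f g s k xs ≡ suc y → runPrec f g s′ k xs ≡ suc y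
  runPrec-mono f g zero    s≤s′ eq = run-mono f s≤s′ eq
  runPrec-mono f g (suc k) s≤s′ eq with runPrec-suc-inv f g eq
  ... | _ , k≡ , g≡ = runPrec-suc-intro f g (runPrec-mono f g k s≤s′ k≡) (run-mono g s≤s′ g≡)

PositiveBelow-fuel : (f : PRF (suc n)) {xs : Vec ℕ n} (y : ℕ) →
                     (∀ w → w < y → ∃[ s ] ∃[ v ] run f s (w ∷ xs) ≡ suc (suc v)) →
                     ∃[ s ] PositiveBelow f s xs y
PositiveBelow-fuel f zero    fuel = 0 , λ w ()
PositiveBelow-fuel f (suc y) fuel
  with PositiveBelow-fuel f y (λ w w<y → fuel w (m<n⇒m<1+n w<y)) | fuel y (n<1+n y)
... | s , below | s′ , v , at-y = s ⊔ s′ , PositiveBelow-suc f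
  (λ w w<y → proj₁ (below w w<y) , run-mono f (m≤m⊔n s s′) (proj₂ (below w w<y)))
  (v , run-mono f (m≤n⊔m s s′) at-y)

mutual
  run-complete : {e : PRF n} {xs : Vec ℕ n} {y : ℕ} → e ⟦ xs ⟧⇓ y → ∃[ s ] run e s xs ≡ suc y
  run-complete ev-zer  = 0 , refl
  run-complete ev-succ = 0 , refl
  run-complete ev-proj = 0 , refl
  run-complete (ev-comp {f = f} {gs = gs} gs⇓ f⇓) with runAll-complete gs⇓ | run-complete f⇓
  ... | s , gs≡ | s′ , f≡ =
    s ⊔ s′ , run-comp-intro f gs (runAll-mono gs (m≤m⊔n s s′) gs≡) (run-mono f (m≤n⊔m s s′) f≡)
  run-complete (ev-prec0 f⇓) = run-complete f⇓
  run-complete (ev-precS {f = f} {g = g} {k = k} k⇓ g⇓) with run-complete k⇓ | run-complete g⇓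
  ... | s , k≡ | s′ , g≡ =
    s ⊔ s′ , runPrec-suc-intro f g (runPrec-mono f g k (m≤m⊔n s s′) k≡) (run-mono g (m≤n⊔m s s′) g≡)
  run-complete (ev-mu {f = f} {y = y} f⇓ below)
    with run-complete f⇓ | PositiveBelow-fuel f y (positive-complete below)
  ... | s , at-y | s′ , below′ = s″ ,
    run-mu-intro f (m≤n⊔m (s ⊔ s′) (suc y)) (run-mono f s≤s″ at-y)
      λ w w<y → proj₁ (below′ w w<y) , run-mono f s′≤s″ (proj₂ (below′ w w<y))
    where
    s″ : ℕ
    s″ = s ⊔ s′ ⊔ suc y
    s≤s″ : s ≤ s″
    s≤s″ = ≤-trans (m≤m⊔n s s′) (m≤m⊔n (s ⊔ s′) (suc y))
    s′≤s″ : s′ ≤ s″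
    s′≤s″ = ≤-trans (m≤n⊔m s s′) (m≤m⊔n (s ⊔ s′) (suc y))

  positive-complete : {f : PRF (suc n)} {xs : Vec ℕ n} {y : ℕ} →
                      (∀ w → w < y → ∃[ v ] f ⟦ w ∷ xs ⟧⇓ suc v) →
                      ∀ w → w < y → ∃[ s ] ∃[ v ] run f s (w ∷ xs) ≡ suc (suc v)
  positive-complete below w w<y with below w w<y
  ... | v , f⇓ with run-complete f⇓
  ... | s , f≡ = s , v , f≡

  runAll-complete : {gs : Vec (PRF n) m} {xs : Vec ℕ n} {ys : Vec ℕ m} →
                    gs ⟦ xs ⟧⇓* ys → ∃[ s ] runAll gs s xs ≡ map suc ys
  runAll-complete ev-[] = 0 , refl
  runAll-complete (ev-∷ {g = g} {gs = gs} g⇓ gs⇓) with run-complete g⇓ | runAll-complete gs⇓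
  ... | s , g≡ | s′ , gs≡ =
    s ⊔ s′ , cong₂ _∷_ (run-mono g (m≤m⊔n s s′) g≡) (runAll-mono gs (m≤n⊔m s s′) gs≡)

-- Total recursive functions

record TotalFn (n : ℕ) : Set where
  constructor totalFn
  field
    fn    : Vec ℕ n → ℕ
    code  : PRF n
    code⇓ : ∀ xs → code ⟦ xs ⟧⇓ fn xs
open TotalFn public

withFn : (c : TotalFn n) (g : Vec ℕ n → ℕ) → (∀ xs → fn c xs ≡ g xs) → TotalFn n
withFn c g eq = totalFn g (code c) λ xs → subst (code c ⟦ xs ⟧⇓_) (eq xs) (code⇓ c xs)

vals : Vec (TotalFn n) m → Vec ℕ n → Vec ℕ m
vals cs xs = map (λ c → fn c xs) cs

codes⇓ : (cs : Vec (TotalFn n) m) (xs : Vec ℕ n) → map code cs ⟦ xs ⟧⇓* vals cs xs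
codes⇓ []       xs = ev-[]
codes⇓ (c ∷ cs) xs = ev-∷ (code⇓ c xs) (codes⇓ cs xs)

compose : TotalFn m → Vec (TotalFn n) m → TotalFn n
compose f cs = totalFn (λ xs → fn f (vals cs xs)) (comp (code f) (map code cs))
                       λ xs → ev-comp (codes⇓ cs xs) (code⇓ f (vals cs xs))

primRecFn : (Vec ℕ n → ℕ) → (Vec ℕ (suc (suc n)) → ℕ) → ℕ → Vec ℕ n → ℕ
primRecFn f g zero    xs = f xs
primRecFn f g (suc k) xs = g (k ∷ primRecFn f g k xs ∷ xs)

primRec : TotalFn n → TotalFn (suc (suc n)) → TotalFn (suc n)
primRec f g = totalFn (λ v → primRecFn (fn f) (fn g) (head v) (tail v)) (prec (code f) (code g)) prec⇓
  where
  prec⇓ : ∀ v → prec (code f) (code g) ⟦ v ⟧⇓ primRecFn (fn f) (fn g) (head v) (tail v)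
  prec⇓ (zero  ∷ xs) = ev-prec0 (code⇓ f xs)
  prec⇓ (suc k ∷ xs) = ev-precS (prec⇓ (k ∷ xs)) (code⇓ g _)

projF : Fin n → TotalFn n
projF i = totalFn (λ xs → lookup xs i) (proj i) λ _ → ev-proj

zeroF : TotalFn n
zeroF = totalFn (λ _ → 0) zer λ _ → ev-zer

succF : TotalFn 1
succF = totalFn (λ v → suc (head v)) succ λ { (x ∷ []) → ev-succ }

app₁ : TotalFn 1 → TotalFn n → TotalFn n
app₁ f a = compose f (a ∷ [])

app₂ : TotalFn 2 → TotalFn n → TotalFn n → TotalFn n
app₂ f a b = compose f (a ∷ b ∷ [])

app₃ : TotalFn 3 → TotalFn n → TotalFn n → TotalFn n → TotalFn n
app₃ f a b c = compose f (a ∷ b ∷ c ∷ [])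

π₀ : TotalFn (suc n)
π₀ = projF fzero

π₁ : TotalFn (2 + n)
π₁ = projF (fsuc fzero)

π₂ : TotalFn (3 + n)
π₂ = projF (fsuc (fsuc fzero))

π₃ : TotalFn (4 + n)
π₃ = projF (fsuc (fsuc (fsuc fzero)))

skip : ∀ k → Vec (TotalFn (k + n)) n
skip k = tabulate λ i → projF (k ↑ʳ i)

vals-skip : ∀ {k} (ys : Vec ℕ k) (xs : Vec ℕ n) → vals (skip k) (ys ++ xs) ≡ xs
vals-skip {k = k} ys xs = begin
  map (λ c → fn c (ys ++ xs)) (tabulate λ i → projF (k ↑ʳ i)) ≡⟨ tabulate-∘ _ _ ⟨
  tabulate (λ i → lookup (ys ++ xs) (k ↑ʳ i))                  ≡⟨ tabulate-cong (lookup-++ʳ ys xs) ⟩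
  tabulate (lookup xs)                                         ≡⟨ tabulate∘lookup xs ⟩
  xs                                                           ∎
  where open ≡-Reasoning

constF : ℕ → TotalFn n
constF k = withFn (constCode k) (λ _ → k) (constCode-fn k)
  where
  constCode : ℕ → TotalFn n
  constCode zero    = zeroF
  constCode (suc k) = app₁ succF (constCode k)
  constCode-fn : ∀ k xs → fn (constCode k) xs ≡ k
  constCode-fn zero    xs = refl
  constCode-fn (suc k) xs = cong suc (constCode-fn k xs)

predF : TotalFn 1
predF = withFn (primRec zeroF π₀) (λ v → pred (head v))
  λ { (zero ∷ []) → refl ; (suc k ∷ []) → refl }

ifZeroF : TotalFn 3
ifZeroF = withFn (primRec π₀ π₃) (λ v → ifZero (head v) (head (tail v)) (head (tail (tail v))))
  λ { (zero ∷ a ∷ b ∷ []) → refl ; (suc k ∷ a ∷ b ∷ []) → refl }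

addF : TotalFn 2
addF = withFn sum (λ v → head v + head (tail v)) λ { (a ∷ b ∷ []) → sum≡ a b }
  where
  sum : TotalFn 2
  sum = primRec π₀ (app₁ succF π₁)
  sum≡ : ∀ a b → fn sum (a ∷ b ∷ []) ≡ a + b
  sum≡ zero    b = refl
  sum≡ (suc a) b = cong suc (sum≡ a b)

monusF : TotalFn 2
monusF = withFn (app₂ monusFlipped π₁ π₀) (λ v → head v ∸ head (tail v))
  λ { (a ∷ b ∷ []) → monus≡ b a }
  where
  monusFlipped : TotalFn 2
  monusFlipped = primRec π₀ (app₁ predF π₁)
  monus≡ : ∀ b a → fn monusFlipped (b ∷ a ∷ []) ≡ a ∸ b
  monus≡ zero    a = refl
  monus≡ (suc b) a = trans (cong pred (monus≡ b a)) (pred[m∸n]≡m∸[1+n] a b)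

∣m-n∣≡m∸n+n∸m : ∀ m n → ∣ m - n ∣ ≡ m ∸ n + (n ∸ m)
∣m-n∣≡m∸n+n∸m zero    n       = cong (_+ n) (sym (0∸n≡0 n))
∣m-n∣≡m∸n+n∸m (suc m) zero    = sym (+-identityʳ (suc m))
∣m-n∣≡m∸n+n∸m (suc m) (suc n) = ∣m-n∣≡m∸n+n∸m m n

distF : TotalFn 2
distF = withFn (app₂ addF (app₂ monusF π₀ π₁) (app₂ monusF π₁ π₀))
  (λ v → ∣ head v - head (tail v) ∣)
  λ { (a ∷ b ∷ []) → sym (∣m-n∣≡m∸n+n∸m a b) }

muTestF : TotalFn 2
muTestF = withFn (primRec zeroF (app₃ ifZeroF π₀ (app₁ succF (app₁ succF π₂)) (constF 1)))
  (λ v → muTest (head v) (head (tail v))) λ { (zero ∷ t ∷ []) → refl ; (suc v ∷ t ∷ []) → refl }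

muStepF : TotalFn 3
muStepF = withFn (primRec zeroF (app₃ ifZeroF π₀ (app₂ muTestF π₂ π₃) (app₁ succF π₀)))
  (λ w → muStep (head w) (head (tail w)) (head (tail (tail w))))
  λ { (zero ∷ v ∷ t ∷ []) → refl ; (suc r ∷ v ∷ t ∷ []) → refl }

whenAllDefinedF : Vec (TotalFn n) m → TotalFn n → TotalFn n
whenAllDefinedF []       b = b
whenAllDefinedF (c ∷ cs) b = app₃ ifZeroF c zeroF (whenAllDefinedF cs b)

whenAllDefinedF-fn : (cs : Vec (TotalFn n) m) (b : TotalFn n) (xs : Vec ℕ n) →
                     fn (whenAllDefinedF cs b) xs ≡ whenAllDefined (vals cs xs) (fn b xs)
whenAllDefinedF-fn []       b xs = refl
whenAllDefinedF-fn (c ∷ cs) b xs = cong (ifZero (fn c xs) 0) (whenAllDefinedF-fn cs b xs)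

vals-map-predF : (cs : Vec (TotalFn n) m) (xs : Vec ℕ n) →
                 vals (map (app₁ predF) cs) xs ≡ map pred (vals cs xs)
vals-map-predF cs xs = trans (sym (map-∘ _ (app₁ predF) cs)) (map-∘ pred (λ c → fn c xs) cs)

RunCode : PRF n → Set
RunCode {n} e = Σ[ c ∈ PRF (suc n) ] (∀ s xs → c ⟦ s ∷ xs ⟧⇓ run e s xs)

runF : (e : PRF n) → RunCode e → TotalFn (suc n)
runF e (c , c⇓) = totalFn (λ v → run e (head v) (tail v)) c λ { (s ∷ xs) → c⇓ s xs }

implementsRun : (e : PRF n) (c : TotalFn (suc n)) → (∀ s xs → fn c (s ∷ xs) ≡ run e s xs) → RunCode e
implementsRun e c eq = code c , λ s xs → subst (code c ⟦ s ∷ xs ⟧⇓_) (eq s xs) (code⇓ c (s ∷ xs))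

mutual
  runCode : (e : PRF n) → RunCode e
  runCode zer      = implementsRun zer (constF 1) λ _ _ → refl
  runCode succ     = implementsRun succ (app₁ succF (app₁ succF π₁)) λ { s (x ∷ []) → refl }
  runCode (proj i) = implementsRun (proj i) (app₁ succF (projF (fsuc i))) λ _ _ → refl
  runCode {n} (comp f gs) with runAllCode gs
  ... | cs , cs≡ = implementsRun (comp f gs) (whenAllDefinedF cs body) comp≡
    where
    body : TotalFn (suc n)
    body = compose (runF f (runCode f)) (π₀ ∷ map (app₁ predF) cs)
    comp≡ : ∀ s xs → fn (whenAllDefinedF cs body) (s ∷ xs) ≡ run (comp f gs) s xs
    comp≡ s xs
      rewrite whenAllDefinedF-fn cs body (s ∷ xs) | vals-map-predF cs (s ∷ xs) | cs≡ s xs = refl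
  runCode {suc n} (prec f g) = implementsRun (prec f g) (compose runPrecF (π₁ ∷ π₀ ∷ skip 2)) prec≡
    where
    step : TotalFn (3 + n)
    step = app₃ ifZeroF π₁ zeroF (compose (runF g (runCode g)) (π₂ ∷ π₀ ∷ app₁ predF π₁ ∷ skip 3))
    runPrecF : TotalFn (2 + n)
    runPrecF = primRec (runF f (runCode f)) step
    runPrecF≡ : ∀ s k xs → fn runPrecF (k ∷ s ∷ xs) ≡ runPrec f g s k xs
    runPrecF≡ s zero    xs = refl
    runPrecF≡ s (suc k) xs
      rewrite vals-skip (k ∷ fn runPrecF (k ∷ s ∷ xs) ∷ s ∷ []) xs | runPrecF≡ s k xs = refl
    prec≡ : ∀ s xs → fn (compose runPrecF (π₁ ∷ π₀ ∷ skip 2)) (s ∷ xs) ≡ run (prec f g) s xs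
    prec≡ s (k ∷ xs) rewrite vals-skip (s ∷ k ∷ []) xs = runPrecF≡ s k xs
  runCode {n} (mu f) = implementsRun (mu f) (app₁ predF (compose runMuF (π₀ ∷ π₀ ∷ skip 1))) mu≡
    where
    step : TotalFn (3 + n)
    step = app₃ muStepF π₁ (compose (runF f (runCode f)) (π₂ ∷ π₀ ∷ skip 3)) π₀
    runMuF : TotalFn (2 + n)
    runMuF = primRec (constF 1) step
    runMuF≡ : ∀ s t xs → fn runMuF (t ∷ s ∷ xs) ≡ runMu f s xs t
    runMuF≡ s zero    xs = refl
    runMuF≡ s (suc t) xs
      rewrite vals-skip (t ∷ fn runMuF (t ∷ s ∷ xs) ∷ s ∷ []) xs | runMuF≡ s t xs = refl
    mu≡ : ∀ s xs → fn (app₁ predF (compose runMuF (π₀ ∷ π₀ ∷ skip 1))) (s ∷ xs) ≡ run (mu f) s xs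
    mu≡ s xs rewrite vals-skip (s ∷ []) xs = cong pred (runMuF≡ s s xs)

  runAllCode : (gs : Vec (PRF n) m) →
               Σ[ cs ∈ Vec (TotalFn (suc n)) m ] (∀ s xs → vals cs (s ∷ xs) ≡ runAll gs s xs)
  runAllCode []       = [] , λ _ _ → refl
  runAllCode (g ∷ gs) with runAllCode gs
  ... | cs , cs≡ = runF g (runCode g) ∷ cs , λ s xs → cong (run g s xs ∷_) (cs≡ s xs)

ifZero-not : ∀ a → ifZero a 1 0 ≡ 0 ⇔ a ≢ 0
ifZero-not zero    = mk⇔ (λ ()) (λ a≢0 → contradiction refl a≢0)
ifZero-not (suc a) = mk⇔ (λ _ ()) (λ _ → refl)

ifZero-or : ∀ a b → ifZero a 0 b ≡ 0 ⇔ (a ≡ 0 ⊎ b ≡ 0)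
ifZero-or zero    b = mk⇔ inj₁ (λ _ → refl)
ifZero-or (suc a) b = mk⇔ inj₂ λ { (inj₁ ()) ; (inj₂ b≡0) → b≡0 }

ifZero-and : ∀ a b → ifZero a b 1 ≡ 0 ⇔ (a ≡ 0 × b ≡ 0)
ifZero-and zero    b = mk⇔ (refl ,_) proj₂
ifZero-and (suc a) b = mk⇔ (λ ()) λ ()

notF : TotalFn 1
notF = app₃ ifZeroF π₀ (constF 1) zeroF

boundedSearch : (ℕ → ℕ) → ℕ → ℕ
boundedSearch P zero    = 0
boundedSearch P (suc t) = ifZero (boundedSearch P t) (ifZero (P t) (suc t) 0) (boundedSearch P t)

boundedSearch-sound : ∀ P t {z} → boundedSearch P t ≡ suc z → z < t × P z ≡ 0
boundedSearch-sound P (suc t) eq with boundedSearch P t in found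
... | suc z′ with boundedSearch-sound P t found
...   | z′<t , Pz′ rewrite suc-injective eq = m<n⇒m<1+n z′<t , Pz′
boundedSearch-sound P (suc t) eq | zero with P t in Pt
... | zero = subst (λ z → z < suc t × P z ≡ 0) (suc-injective eq) (n<1+n t , Pt)

boundedSearch-complete : ∀ P t {z} → z < t → P z ≡ 0 → boundedSearch P t ≢ 0
boundedSearch-complete P (suc t) {z} z<1+t Pz with boundedSearch P t in found
... | suc _ = λ ()
... | zero with m<1+n⇒m<n∨m≡n z<1+t
...   | inj₁ z<t  = contradiction found (boundedSearch-complete P t z<t Pz)
...   | inj₂ refl rewrite Pz = λ ()

boundedSearchF : TotalFn (suc n) → TotalFn (suc n)
boundedSearchF {n} P = withFn search (λ v → boundedSearch (λ z → fn P (z ∷ tail v)) (head v))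
  λ { (t ∷ xs) → search≡ t xs }
  where
  search : TotalFn (suc n)
  search = primRec zeroF
    (app₃ ifZeroF π₁ (app₃ ifZeroF (compose P (π₀ ∷ skip 2)) (app₁ succF π₀) zeroF) π₁)
  search≡ : ∀ t xs → fn search (t ∷ xs) ≡ boundedSearch (λ z → fn P (z ∷ xs)) t
  search≡ zero    xs = refl
  search≡ (suc t) xs rewrite vals-skip (t ∷ fn search (t ∷ xs) ∷ []) xs | search≡ t xs = refl

least-witness : {P : ℕ → Set} → (∀ z → Dec (P z)) → ∀ b → P b → ∃[ m ] (P m × ∀ w → w < m → ¬ P w)
least-witness {P} P? = <-rec (λ b → P b → ∃[ m ] (P m × ∀ w → w < m → ¬ P w)) step
  where
  step : ∀ b → (∀ {c} → c < b → P c → ∃[ m ] (P m × ∀ w → w < m → ¬ P w)) → P b →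
         ∃[ m ] (P m × ∀ w → w < m → ¬ P w)
  step b smaller Pb with anyUpTo? P? b
  ... | yes (c , c<b , Pc) = smaller c<b Pc
  ... | no none            = b , Pb , λ w w<b Pw → none (w , w<b , Pw)

least-zero : (P : TotalFn (suc n)) (xs : Vec ℕ n) → ∃[ z ] fn P (z ∷ xs) ≡ 0 →
             ∃[ m ] (fn P (m ∷ xs) ≡ 0 × ∀ w → w < m → fn P (w ∷ xs) ≢ 0)
least-zero P xs (z , Pz) = least-witness (λ w → fn P (w ∷ xs) ≟ 0) z Pz

mu⇓ : (P : TotalFn (suc n)) {xs : Vec ℕ n} {m : ℕ} →
      fn P (m ∷ xs) ≡ 0 → (∀ w → w < m → fn P (w ∷ xs) ≢ 0) → mu (code P) ⟦ xs ⟧⇓ m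
mu⇓ P {xs} {m} Pm below = ev-mu (subst (code P ⟦ m ∷ xs ⟧⇓_) Pm (code⇓ P (m ∷ xs))) positive
  where
  positive : ∀ w → w < m → ∃[ v ] code P ⟦ w ∷ xs ⟧⇓ suc v
  positive w w<m with fn P (w ∷ xs) in Pw
  ... | zero  = contradiction Pw (below w w<m)
  ... | suc v = v , subst (code P ⟦ w ∷ xs ⟧⇓_) Pw (code⇓ P (w ∷ xs))

minimise : (P : TotalFn (suc n)) → (∀ xs → ∃[ z ] fn P (z ∷ xs) ≡ 0) → TotalFn n
minimise P total = totalFn (λ xs → proj₁ (least-zero P xs (total xs))) (mu (code P))
  λ xs → let (_ , Pm , below) = least-zero P xs (total xs) in mu⇓ P Pm below

minimise-zero : (P : TotalFn (suc n)) (total : ∀ xs → ∃[ z ] fn P (z ∷ xs) ≡ 0) (xs : Vec ℕ n) →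
                fn P (fn (minimise P total) xs ∷ xs) ≡ 0
minimise-zero P total xs = proj₁ (proj₂ (least-zero P xs (total xs)))

-- Computable and c.e. sets

toTotalFn : {f : ℕ → ℕ} → ComputableFn f → TotalFn 1
toTotalFn {f} (e , e⇓) = totalFn (λ v → f (head v)) e λ { (x ∷ []) → e⇓ x }

TotalFn⇒ComputableFn : (c : TotalFn 1) → ComputableFn (λ x → fn c (x ∷ []))
TotalFn⇒ComputableFn c = code c , λ x → code⇓ c (x ∷ [])

computable : {A : Pred} (c : TotalFn 1) → (∀ x → A x ⇔ fn c (x ∷ []) ≡ 0) → Computable A
computable c spec = (λ x → fn c (x ∷ [])) , TotalFn⇒ComputableFn c , spec

characteristicF : {A : Pred} → Computable A → TotalFn 1
characteristicF (_ , χ-fn , _) = toTotalFn χ-fn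

ifZero-computable : {c a b : ℕ → ℕ} → ComputableFn c → ComputableFn a → ComputableFn b →
                    ComputableFn (λ x → ifZero (c x) (a x) (b x))
ifZero-computable c a b = TotalFn⇒ComputableFn (app₃ ifZeroF (toTotalFn c) (toTotalFn a) (toTotalFn b))

Computable-resp-⇔ : {A B : Pred} → (∀ x → A x ⇔ B x) → Computable B → Computable A
Computable-resp-⇔ A⇔B (χ , χ-fn , spec) = χ , χ-fn , λ x → spec x ⇔-∘ A⇔B x

∁-computable : {A : Pred} → Computable A → Computable (∁ A)
∁-computable cA@(χ , _ , spec) = computable (app₁ notF (characteristicF cA)) λ x →
  mk⇔ (λ ¬Ax → from (ifZero-not (χ x)) (λ χx≡0 → ¬Ax (from (spec x) χx≡0)))
      (λ χ′x≡0 Ax → to (ifZero-not (χ x)) χ′x≡0 (to (spec x) Ax))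

∩-computable : {A B : Pred} → Computable A → Computable B → Computable (A ∩ B)
∩-computable cA@(χA , _ , specA) cB@(χB , _ , specB) =
  computable (app₃ ifZeroF (characteristicF cA) (characteristicF cB) (constF 1)) λ x →
    mk⇔ (λ (Ax , Bx) → from (ifZero-and (χA x) (χB x)) (to (specA x) Ax , to (specB x) Bx))
        (λ χ≡0 → let (χAx≡0 , χBx≡0) = to (ifZero-and (χA x) (χB x)) χ≡0 in
                 from (specA x) χAx≡0 , from (specB x) χBx≡0)

≥-computable : ∀ N → Computable (N ≤_)
≥-computable N = computable (app₂ monusF (constF N) π₀) λ x → mk⇔ m≤n⇒m∸n≡0 m∸n≡0⇒m≤n

∈-computable : {f : ℕ → ℕ} → ComputableFn f → (L : List ℕ) → Computable (λ x → f x ∈ L)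
∈-computable {f} f-fn L = computable (memberF L) (member≡0 L)
  where
  memberF : List ℕ → TotalFn 1
  memberF []ᴸ      = constF 1
  memberF (c ∷ᴸ L) = app₃ ifZeroF (app₂ distF (toTotalFn f-fn) (constF c)) zeroF (memberF L)
  member≡0 : ∀ L x → f x ∈ L ⇔ fn (memberF L) (x ∷ []) ≡ 0
  member≡0 []ᴸ      x = mk⇔ (λ ()) (λ ())
  member≡0 (c ∷ᴸ L) x = mk⇔ (from (ifZero-or ∣ f x - c ∣ _) ∘ here-or-there)
                            (there-or-here ∘ to (ifZero-or ∣ f x - c ∣ _))
    where
    here-or-there : f x ∈ c ∷ᴸ L → ∣ f x - c ∣ ≡ 0 ⊎ fn (memberF L) (x ∷ []) ≡ 0
    here-or-there (here fx≡c)  = inj₁ (m≡n⇒∣m-n∣≡0 fx≡c)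
    here-or-there (there fx∈L) = inj₂ (to (member≡0 L x) fx∈L)
    there-or-here : ∣ f x - c ∣ ≡ 0 ⊎ fn (memberF L) (x ∷ []) ≡ 0 → f x ∈ c ∷ᴸ L
    there-or-here (inj₁ dist≡0) = here (∣m-n∣≡0⇒m≡n dist≡0)
    there-or-here (inj₂ rest≡0) = there (from (member≡0 L x) rest≡0)

Σ₁⇒CE : {A : Pred} (P : TotalFn 2) → (∀ x → A x ⇔ (∃[ s ] fn P (s ∷ x ∷ []) ≡ 0)) → CE A
Σ₁⇒CE P spec = mu (code P) , λ x → mk⇔
  (λ Ax → let (m , Pm , below) = least-zero P (x ∷ []) (to (spec x) Ax) in m , mu⇓ P Pm below)
  (λ { (s , ev-mu P⇓0 _) → from (spec x) (s , ⇓-functional (code⇓ P (s ∷ x ∷ [])) P⇓0) })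

computable⇒CE : {A : Pred} → Computable A → CE A
computable⇒CE cA@(χ , _ , spec) = Σ₁⇒CE (app₁ (characteristicF cA) π₁) λ x →
  mk⇔ (λ Ax → 0 , to (spec x) Ax) (λ (_ , χx≡0) → from (spec x) χx≡0)

record Clocked (A : Pred) : Set where
  field
    clock          : TotalFn 2
    clock-sound    : ∀ {s x} → fn clock (s ∷ x ∷ []) ≡ 0 → A x
    clock-complete : ∀ {x} → A x → ∃[ s ] fn clock (s ∷ x ∷ []) ≡ 0
    clock-mono     : ∀ {s s′ x} → s ≤ s′ → fn clock (s ∷ x ∷ []) ≡ 0 → fn clock (s′ ∷ x ∷ []) ≡ 0

CE⇒Clocked : {A : Pred} → CE A → Clocked A
CE⇒Clocked {A} (e , spec) = record
  { clock          = app₁ notF (runF e (runCode e))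
  ; clock-sound    = sound
  ; clock-complete = complete
  ; clock-mono     = mono
  }
  where
  defined : ∀ {s x} → ifZero (run e s (x ∷ [])) 1 0 ≡ 0 → ∃[ y ] run e s (x ∷ []) ≡ suc y
  defined {s} {x} eq with run e s (x ∷ [])
  ... | suc y = y , refl
  sound : ∀ {s x} → ifZero (run e s (x ∷ [])) 1 0 ≡ 0 → A x
  sound {s} {x} eq = let (y , run≡) = defined eq in from (spec x) (y , run-sound e run≡)
  complete : ∀ {x} → A x → ∃[ s ] ifZero (run e s (x ∷ [])) 1 0 ≡ 0
  complete {x} Ax with run-complete (proj₂ (to (spec x) Ax))
  ... | s , run≡ = s , cong (λ r → ifZero r 1 0) run≡
  mono : ∀ {s s′ x} → s ≤ s′ → ifZero (run e s (x ∷ [])) 1 0 ≡ 0 → ifZero (run e s′ (x ∷ [])) 1 0 ≡ 0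
  mono s≤s′ eq = let (y , run≡) = defined eq in cong (λ r → ifZero r 1 0) (run-mono e s≤s′ run≡)

Clocked-≤m : {A B : Pred} → B ≤m A → Clocked A → Clocked B
Clocked-≤m (h , h-fn , reduces) KA = record
  { clock          = compose clock (π₀ ∷ app₁ (toTotalFn h-fn) π₁ ∷ [])
  ; clock-sound    = λ {_} {x} eq → from (reduces x) (clock-sound eq)
  ; clock-complete = λ {x} Bx → clock-complete (to (reduces x) Bx)
  ; clock-mono     = clock-mono
  }
  where open Clocked KA

Clocked-∪-computable : {A R : Pred} → Clocked A → Computable R → CE (A ∪ R)
Clocked-∪-computable {A} {R} KA cR@(χ , _ , spec) =
  Σ₁⇒CE (app₃ ifZeroF (app₁ (characteristicF cR) π₁) zeroF clock) λ x →
    mk⇔ (enumerated x) (member x)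
  where
  open Clocked KA
  enumerated : ∀ x → (A ∪ R) x → ∃[ s ] ifZero (χ x) 0 (fn clock (s ∷ x ∷ [])) ≡ 0
  enumerated x (inj₁ Ax) = let (s , eq) = clock-complete Ax in s , from (ifZero-or (χ x) _) (inj₂ eq)
  enumerated x (inj₂ Rx) = 0 , from (ifZero-or (χ x) _) (inj₁ (to (spec x) Rx))
  member : ∀ x → ∃[ s ] ifZero (χ x) 0 (fn clock (s ∷ x ∷ [])) ≡ 0 → (A ∪ R) x
  member x (s , eq) with to (ifZero-or (χ x) _) eq
  ... | inj₁ χx≡0 = inj₂ (from (spec x) χx≡0)
  ... | inj₂ clock≡0 = inj₁ (clock-sound clock≡0)

-- Finite sets and reductions

Finite-⊆ : {P Q : Pred} → P ⊆ Q → Finite Q → Finite P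
Finite-⊆ P⊆Q (n , bound) = n , λ x Px → bound x (P⊆Q x Px)

Finite-∪ : {P Q : Pred} → Finite P → Finite Q → Finite (P ∪ Q)
Finite-∪ (m , boundP) (n , boundQ) = m ⊔ n , λ
  { x (inj₁ Px) → <-≤-trans (boundP x Px) (m≤m⊔n m n)
  ; x (inj₂ Qx) → <-≤-trans (boundQ x Qx) (m≤n⊔m m n)
  }

subsingleton-finite : ExcludedMiddle 0ℓ → {P : Pred} → (∀ x x′ → P x → P x′ → x ≡ x′) → Finite P
subsingleton-finite lem {P} unique with lem {∃[ x ] P x}
... | yes (x₀ , Px₀) = suc x₀ , λ x Px → s≤s (≤-reflexive (unique x x₀ Px Px₀))
... | no none        = 0 , λ x Px → contradiction (x , Px) none

∃-below-weaken : {P : ℕ → Set} {N : ℕ} → ∃[ z ] (z < N × P z) → ∃[ z ] (z < suc N × P z)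
∃-below-weaken (z , z<N , Pz) = z , m<n⇒m<1+n z<N , Pz

∃-below-strengthen : {P : ℕ → Set} {N : ℕ} → ¬ P N → ∃[ z ] (z < suc N × P z) → ∃[ z ] (z < N × P z)
∃-below-strengthen ¬PN (z , z<1+N , Pz) with m<1+n⇒m<n∨m≡n z<1+N
... | inj₁ z<N  = z , z<N , Pz
... | inj₂ refl = contradiction Pz ¬PN

imageBelow : ExcludedMiddle 0ℓ → (Q : Pred) (f : ℕ → ℕ) (N : ℕ) →
             Σ[ L ∈ List ℕ ] (∀ y → y ∈ L ⇔ (∃[ z ] (z < N × Q z × y ≡ f z)))
imageBelow lem Q f zero = []ᴸ , λ y → mk⇔ (λ ()) (λ ())
imageBelow lem Q f (suc N) with imageBelow lem Q f N | lem {Q N}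
... | L , spec | no ¬QN =
  L , λ y → mk⇔ (∃-below-weaken ∘ to (spec y)) (from (spec y) ∘ ∃-below-strengthen (¬QN ∘ proj₁))
... | L , spec | yes QN = f N ∷ᴸ L , λ y → mk⇔ (enumerated y) (listed y)
  where
  enumerated : ∀ y → y ∈ f N ∷ᴸ L → ∃[ z ] (z < suc N × Q z × y ≡ f z)
  enumerated y (here y≡fN) = N , n<1+n N , QN , y≡fN
  enumerated y (there y∈L) = ∃-below-weaken (to (spec y) y∈L)
  listed : ∀ y → ∃[ z ] (z < suc N × Q z × y ≡ f z) → y ∈ f N ∷ᴸ L
  listed y (z , z<1+N , Qz , y≡fz) with m<1+n⇒m<n∨m≡n z<1+N
  ... | inj₁ z<N  = there (from (spec y) (z , z<N , Qz , y≡fz))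
  ... | inj₂ refl = here y≡fz

≤m-refl : {A : Pred} → A ≤m A
≤m-refl = id , (proj fzero , λ _ → ev-proj) , λ _ → mk⇔ id id

≤m-respects-fibres : {A B : Pred} ((f , _ , _) : A ≤m B) {x z : ℕ} → f x ≡ f z → A x → A z
≤m-respects-fibres {B = B} (f , _ , reduces) {x} {z} fx≡fz Ax =
  from (reduces z) (subst B fx≡fz (to (reduces x) Ax))

Unbounded : Pred → Set
Unbounded B = ∀ k → ∃[ x ] (k ≤ x × B x)

≤m-Unbounded : ExcludedMiddle 0ℓ → {A B : Pred} → ¬ Computable A → A ≤m B → Unbounded B
≤m-Unbounded lem {A} {B} ¬cA (f , f-fn , reduces) k with lem {∃[ x ] (k ≤ x × B x)}
... | yes found = found
... | no none with imageBelow lem B id k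
...   | L , L-spec = contradiction (Computable-resp-⇔ A⇔fx∈L (∈-computable f-fn L)) ¬cA
  where
  listed : ∀ {x} → A x → f x ∈ L
  listed {x} Ax with f x <? k
  ... | yes fx<k = from (L-spec (f x)) (f x , fx<k , to (reduces x) Ax , refl)
  ... | no  fx≮k = contradiction (f x , ≮⇒≥ fx≮k , to (reduces x) Ax) none
  A⇔fx∈L : ∀ x → A x ⇔ f x ∈ L
  A⇔fx∈L x = mk⇔ listed λ fx∈L →
    let (z , _ , Bz , fx≡z) = to (L-spec (f x)) fx∈L in from (reduces x) (subst B (sym fx≡z) Bz)

Selector : Pred → Set
Selector B = Σ[ b ∈ (ℕ → ℕ) ] (ComputableFn b × (∀ k → k ≤ b k × B (b k)))

-- b k = k + j for the first stage n at which some k + j with j ≤ n has been enumerated.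
Clocked⇒Selector : {B : Pred} → Clocked B → Unbounded B → Selector B
Clocked⇒Selector {B} KB unbounded =
  (λ k → fn selectorF (k ∷ [])) , TotalFn⇒ComputableFn selectorF , selects
  where
  open Clocked KB
  searchF : TotalFn 3
  searchF = boundedSearchF (compose clock (π₁ ∷ app₂ addF π₂ π₀ ∷ []))
  notFoundF : TotalFn 2
  notFoundF = app₁ notF (compose searchF (app₁ succF π₀ ∷ π₀ ∷ π₁ ∷ []))
  eventually-found : ∀ v → ∃[ n ] fn notFoundF (n ∷ v) ≡ 0
  eventually-found (k ∷ []) with unbounded k
  ... | x , k≤x , Bx with clock-complete Bx
  ...   | s , enumerated-at-s =
    s ⊔ (x ∸ k) , from (ifZero-not _) (boundedSearch-complete _ _ (s≤s (m≤n⊔m s (x ∸ k))) enumerated)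
    where
    enumerated : fn clock (s ⊔ (x ∸ k) ∷ k + (x ∸ k) ∷ []) ≡ 0
    enumerated rewrite m+[n∸m]≡n k≤x = clock-mono (m≤m⊔n s (x ∸ k)) enumerated-at-s
  stageF : TotalFn 1
  stageF = minimise notFoundF eventually-found
  selectorF : TotalFn 1
  selectorF = app₂ addF π₀ (app₁ predF (compose searchF (app₁ succF stageF ∷ stageF ∷ π₀ ∷ [])))
  stage : ℕ → ℕ
  stage k = fn stageF (k ∷ [])
  selects : ∀ k → k ≤ fn selectorF (k ∷ []) × B (fn selectorF (k ∷ []))
  selects k with fn searchF (suc (stage k) ∷ stage k ∷ k ∷ []) in found
  ... | zero  =
    contradiction found (to (ifZero-not _) (minimise-zero notFoundF eventually-found (k ∷ [])))
  ... | suc j = m≤m+n k j , clock-sound (proj₂ (boundedSearch-sound _ (suc (stage k)) found))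

Repeated : (ℕ → ℕ) → Pred
Repeated f x = ∃[ z ] (z < x × f z ≡ f x)

Repeated-computable : {f : ℕ → ℕ} → ComputableFn f → Computable (Repeated f)
Repeated-computable {f} f-fn = computable repeatedF λ x →
  mk⇔ (λ (z , z<x , fz≡fx) →
         from (ifZero-not _) (boundedSearch-complete (gap x) x z<x (m≡n⇒∣m-n∣≡0 fz≡fx)))
      (found x ∘ to (ifZero-not _))
  where
  F : TotalFn 1
  F = toTotalFn f-fn
  repeatedF : TotalFn 1
  repeatedF = app₁ notF (compose (boundedSearchF (app₂ distF (app₁ F π₀) (app₁ F π₁))) (π₀ ∷ π₀ ∷ []))
  gap : ℕ → ℕ → ℕ
  gap x z = ∣ f z - f x ∣
  found : ∀ x → boundedSearch (gap x) x ≢ 0 → Repeated f x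
  found x ≢0 with boundedSearch (gap x) x in search≡
  ... | zero  = contradiction refl ≢0
  ... | suc z = let (z<x , gap≡0) = boundedSearch-sound (gap x) x search≡ in
                z , z<x , ∣m-n∣≡0⇒m≡n gap≡0

least-preimage : (f : ℕ → ℕ) (x : ℕ) → ∃[ x₀ ] (f x₀ ≡ f x × ¬ Repeated f x₀)
least-preimage f x with least-witness (λ z → f z ≟ f x) x refl
... | x₀ , fx₀≡fx , below = x₀ , fx₀≡fx , λ (z , z<x₀ , fz≡fx₀) → below z z<x₀ (trans fz≡fx₀ fx₀≡fx)

unrepeated-injective : (f : ℕ → ℕ) {x x′ : ℕ} → f x ≡ f x′ → ¬ Repeated f x → ¬ Repeated f x′ → x ≡ x′
unrepeated-injective f {x} {x′} fx≡fx′ new new′ with <-cmp x x′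
... | tri< x<x′ _ _ = contradiction (x , x<x′ , fx≡fx′) new′
... | tri≈ _ x≡x′ _ = x≡x′
... | tri> _ _ x′<x = contradiction (x′ , x′<x , sym fx≡fx′) new

unrepeated-preimage-finite : ExcludedMiddle 0ℓ → (f : ℕ → ℕ) (y : ℕ) →
                             Finite (λ x → f x ≡ y × ¬ Repeated f x)
unrepeated-preimage-finite lem f y = subsingleton-finite lem λ x x′ (fx≡y , new) (fx′≡y , new′) →
  unrepeated-injective f (trans fx≡y (sym fx′≡y)) new new′

cofinitely-repeated⇒computable : ExcludedMiddle 0ℓ → {A B : Pred} (r : A ≤m B) →
                                 Finite (∁ A ∖ Repeated (proj₁ r)) → Computable A
cofinitely-repeated⇒computable lem {A} {B} r@(f , f-fn , _) (N , bound) with imageBelow lem (∁ A) f N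
... | L , L-spec = Computable-resp-⇔ A⇔fx∉L (∁-computable (∈-computable f-fn L))
  where
  unlisted : ∀ {x} → A x → f x ∈ L → ⊥
  unlisted Ax fx∈L =
    let (z , _ , ¬Az , fx≡fz) = to (L-spec _) fx∈L in ¬Az (≤m-respects-fibres {B = B} r fx≡fz Ax)
  -- The least preimage x₀ of f x is not repeated, so lies below N if it is outside A.
  member : ∀ {x} → ¬ f x ∈ L → A x
  member {x} fx∉L with lem {A x}
  ... | yes Ax = Ax
  ... | no ¬Ax with least-preimage f x
  ...   | x₀ , fx₀≡fx , new =
    contradiction (from (L-spec (f x)) (x₀ , bound x₀ (¬Ax₀ , new) , ¬Ax₀ , sym fx₀≡fx)) fx∉L
    where
    ¬Ax₀ : ¬ A x₀
    ¬Ax₀ Ax₀ = ¬Ax (≤m-respects-fibres {B = B} r fx₀≡fx Ax₀)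
  A⇔fx∉L : ∀ x → A x ⇔ (¬ f x ∈ L)
  A⇔fx∉L x = mk⇔ unlisted member

repeated-nonmembers-finite : ExcludedMiddle 0ℓ → {A B : Pred} → DMaximal A → Type1 A → (r : A ≤m B) →
                             Finite (Repeated (proj₁ r) ∖ A)
repeated-nonmembers-finite lem {A} {B} (ceA , ¬cA , dmax) type1 r@(f , f-fn , _)
  with dmax (A ∪ Repeated f) (Clocked-∪-computable (CE⇒Clocked ceA) (Repeated-computable f-fn))
            (λ _ → inj₁)
... | inj₁ ce-difference =
  Finite-⊆ (λ x (rep , ¬Ax) → inj₂ rep , ¬Ax) (type1 _ ce-difference λ x (_ , ¬Ax) Ax → ¬Ax Ax)
... | inj₂ (R , cR , A⊆R , R⊆A∪Rep) =
  contradiction (cofinitely-repeated⇒computable lem {B = B} r unrepeated-finite) ¬cA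
  where
  outside-R : ∀ x → (∁ A ∖ Repeated f) x → ∁ R x
  outside-R x (¬Ax , new) Rx with R⊆A∪Rep x Rx
  ... | inj₁ Ax  = ¬Ax Ax
  ... | inj₂ rep = new rep
  unrepeated-finite : Finite (∁ A ∖ Repeated f)
  unrepeated-finite =
    Finite-⊆ outside-R (type1 (∁ R) (computable⇒CE (∁-computable cR)) λ x ¬Rx Ax → ¬Rx (A⊆R x Ax))

-- g agrees with f except on the repeated elements from N on, which all lie in A and are
-- sent by the selector above themselves.
≤fo-from-selector : ExcludedMiddle 0ℓ → {A B : Pred} (r : A ≤m B) → Selector B →
                    Finite (Repeated (proj₁ r) ∖ A) → A ≤fo B
≤fo-from-selector lem {A} {B} (f , f-fn , reduces) (b , b-fn , selects) (N , bound) =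
  g , ifZero-computable χ-fn b-fn f-fn , g-reduces , g-finite-one
  where
  S : Pred
  S = Repeated f ∩ (N ≤_)
  cS : Computable S
  cS = ∩-computable (Repeated-computable f-fn) (≥-computable N)
  χ : ℕ → ℕ
  χ = proj₁ cS
  χ-fn : ComputableFn χ
  χ-fn = proj₁ (proj₂ cS)
  g : ℕ → ℕ
  g x = ifZero (χ x) (b x) (f x)
  S⇔χ≡0 : ∀ x → S x ⇔ χ x ≡ 0
  S⇔χ≡0 = proj₂ (proj₂ cS)
  S⊆A : S ⊆ A
  S⊆A x (rep , N≤x) with lem {A x}
  ... | yes Ax = Ax
  ... | no ¬Ax = contradiction (bound x (rep , ¬Ax)) (≤⇒≯ N≤x)
  g-reduces : ∀ x → A x ⇔ B (g x)
  g-reduces x with χ x in χx≡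
  ... | zero  = mk⇔ (λ _ → proj₂ (selects x)) (λ _ → S⊆A x (from (S⇔χ≡0 x) χx≡))
  ... | suc _ = reduces x
  fibre-covered : ∀ y x → g x ≡ y → (((_≤ y) ∪ (_< N)) ∪ (λ x → f x ≡ y × ¬ Repeated f x)) x
  fibre-covered y x gx≡y with χ x in χx≡
  ... | zero  = inj₁ (inj₁ (subst (x ≤_) gx≡y (proj₁ (selects x))))
  ... | suc _ with x <? N
  ...   | yes x<N = inj₁ (inj₂ x<N)
  ...   | no  x≮N = inj₂ (gx≡y , λ rep → 0≢1+n (trans (sym (to (S⇔χ≡0 x) (rep , ≮⇒≥ x≮N))) χx≡))
  g-finite-one : ∀ y → Finite (λ x → g x ≡ y)
  g-finite-one y = Finite-⊆ (fibre-covered y)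
    (Finite-∪ (Finite-∪ (suc y , λ _ → s≤s) (N , λ _ → id)) (unrepeated-preimage-finite lem f y))

proposition4p2 : ExcludedMiddle 0ℓ →
    (A : Pred) → CE A → ¬ Computable A → DMaximal A → Type1 A →
    Σ[ C ∈ Pred ] (C ≡m A × (∀ (B : Pred) → B ≡m A → C ≤fo B))
proposition4p2 lem A ceA ¬cA dmax type1 = A , (≤m-refl , ≤m-refl) , least
  where
  least : ∀ B → B ≡m A → A ≤fo B
  least B (B≤A , A≤B) = ≤fo-from-selector lem {B = B} A≤B
    (Clocked⇒Selector (Clocked-≤m B≤A (CE⇒Clocked ceA)) (≤m-Unbounded lem {B = B} ¬cA A≤B))
    (repeated-nonmembers-finite lem {B = B} dmax type1 A≤B)
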